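{- Let $n$ be an even positive integer. If $n$ is not expressible as a single power of $2$ or as a sum of two powers of $2$, then $\log_2 n+1\leq\|n\|_2$.
   Context: For an even positive integer $n$, the $2$-complexity $\|n\|_2$ is the minimal number of copies of $2$ needed to express $n$ from $2$ using only addition and multiplication (and parentheses). Equivalently, $\|2\|_2=1$ and $\|n\|_2=\min(\|a\|_2+\|b\|_2)$, the minimum over even positive $a,b$ with $a+b=n$ or $ab=n$. -}

module Defs where

open import Data.Nat using (ℕ; suc; _+_; _*_)

data Expr : Set where
  two  : Expr
  _⊕_  : Expr → Expr → Expr
  _⊗_  : Expr → Expr → Expr

⟦_⟧ : Expr → ℕ
⟦ two ⟧   = 2
⟦ a ⊕ b ⟧ = ⟦ a ⟧ + ⟦ b ⟧
⟦ a ⊗ b ⟧ = ⟦ a ⟧ * ⟦ b ⟧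

twos : Expr → ℕ
twos two     = 1
twos (a ⊕ b) = twos a + twos b
twos (a ⊗ b) = twos a + twos b

-- "k ≤ ‖n‖₂": every expression for n uses at least k copies of 2
-- (‖n‖₂ is the minimum of twos e over expressions e with ⟦ e ⟧ = n).
infix 4 _≤‖_‖₂
_≤‖_‖₂ : ℕ → ℕ → Set
k ≤‖ n ‖₂ = (e : Expr) → ⟦ e ⟧ ≡ n → k Data.Nat.≤ twos e
  where open import Relation.Binary.PropositionalEquality using (_≡_)

{-# OPTIONS --safe #-}
-- A value v built from k copies of 2 satisfies v ≤ 2 ^ (k - 1), unless it is
-- 2 ^ k itself or of the form 2 ^ (k - 1) + 2 ^ i with 1 ≤ i ≤ k - 2; this
-- trichotomy is preserved by + and * (induction on the expression), the only
-- delicate cases being 2 + 2 ^ k and products of two values of the third form.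
-- If n has neither exceptional form then 2 n ≤ 2 ^ ‖n‖₂, i.e. log₂ n + 1 ≤ ‖n‖₂.
module Submission where

open import Defs
open import Data.Nat using (ℕ; zero; suc; _+_; _*_; _^_; _≤_; z≤n; s≤s; NonZero; ≢-nonZero)
open import Data.Nat.Logarithm using (⌈log₂_⌉; ⌈log₂⌉-mono-≤; ⌈log₂2*n⌉≡1+⌈log₂n⌉; ⌈log₂2^n⌉≡n)
open import Data.Nat.Properties
open import Data.Nat.Tactic.RingSolver using (solve-∀)
open import Data.Empty using (⊥-elim)
open import Data.Product using (∃; _,_)
open import Algebra.Definitions.RawMagma using (_,_)
open import Data.Sum using (_⊎_; inj₁; inj₂)
open import Relation.Binary.PropositionalEquality

2*[m+n]≤m*n : ∀ {m n} → 4 ≤ m → 4 ≤ n → 2 * (m + n) ≤ m * n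
2*[m+n]≤m*n p q with ≤⇒≤″ p | ≤⇒≤″ q
... | a , refl | b , refl = ≤″⇒≤ (2 * a + 2 * b + a * b , identity a b)
  where
  identity : ∀ a b → 2 * (4 + a + (4 + b)) + (2 * a + 2 * b + a * b) ≡ (4 + a) * (4 + b)
  identity = solve-∀

2+m*[1+n]≤m*[2*n] : ∀ {m n} → 2 ≤ m → 2 ≤ n → 2 + m * (1 + n) ≤ m * (2 * n)
2+m*[1+n]≤m*[2*n] p q with ≤⇒≤″ p | ≤⇒≤″ q
... | a , refl | b , refl = ≤″⇒≤ (a + 2 * b + a * b , identity a b)
  where
  identity : ∀ a b → 2 + (2 + a) * (1 + (2 + b)) + (a + 2 * b + a * b) ≡ (2 + a) * (2 * (2 + b))
  identity = solve-∀

[1+m]*[1+n]≤2*[m*n] : ∀ {m n} → 4 ≤ m → 2 ≤ n → (1 + m) * (1 + n) ≤ 2 * (m * n)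
[1+m]*[1+n]≤2*[m*n] p q with ≤⇒≤″ p | ≤⇒≤″ q
... | a , refl | b , refl = ≤″⇒≤ (1 + a + 3 * b + a * b , identity a b)
  where
  identity : ∀ a b → (1 + (4 + a)) * (1 + (2 + b)) + (1 + a + 3 * b + a * b) ≡ 2 * ((4 + a) * (2 + b))
  identity = solve-∀

2≤2^[1+n] : ∀ n → 2 ≤ 2 ^ suc n
2≤2^[1+n] n = ^-monoʳ-≤ 2 {1} {suc n} (s≤s z≤n)

4≤2^n : ∀ {n} → 2 ≤ n → 4 ≤ 2 ^ n
4≤2^n = ^-monoʳ-≤ 2 {2}

data Shape : ℕ → ℕ → Set where
  small     : ∀ {v k} → 2 * v ≤ 2 ^ k → Shape v k
  power     : ∀ k → Shape (2 ^ k) k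
  -- 2 ^ (1 + j) + 2 ^ (k - 1) for k = 3 + j + t
  twoPowers : ∀ j t → Shape (2 ^ suc j * (1 + 2 ^ suc t)) (suc j + suc (suc t))

Shape-≤ : ∀ {v k} → Shape v k → v ≤ 2 ^ k
Shape-≤ {v} (small p) = ≤-trans (m≤n*m v 2) p
Shape-≤ (power k) = ≤-refl
Shape-≤ (twoPowers j t) = begin
  2 ^ suc j * (1 + 2 ^ suc t)        ≤⟨ m≤n+m _ 2 ⟩
  2 + 2 ^ suc j * (1 + 2 ^ suc t)    ≤⟨ 2+m*[1+n]≤m*[2*n] (2≤2^[1+n] j) (2≤2^[1+n] t) ⟩
  2 ^ suc j * 2 ^ suc (suc t)        ≡⟨ ^-distribˡ-+-* 2 (suc j) (suc (suc t)) ⟨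
  2 ^ (suc j + suc (suc t))          ∎
  where open ≤-Reasoning

Shape-+-comm : ∀ {a b k l} → Shape (a + b) (k + l) → Shape (b + a) (l + k)
Shape-+-comm {a} {b} {k} {l} = subst₂ Shape (+-comm a b) (+-comm k l)

Shape-*-comm : ∀ {a b k l} → Shape (a * b) (k + l) → Shape (b * a) (l + k)
Shape-*-comm {a} {b} {k} {l} = subst₂ Shape (*-comm a b) (+-comm k l)

2+-small : ∀ {v x} → 4 ≤ x → 2 * v ≤ x → 2 * (2 + v) ≤ 2 * x
2+-small {v} {x} p q = begin
  2 * (2 + v)  ≡⟨ *-distribˡ-+ 2 2 v ⟩
  4 + 2 * v    ≤⟨ +-mono-≤ p q ⟩
  x + x        ≡⟨ cong (x +_) (+-identityʳ x) ⟨
  2 * x        ∎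
  where open ≤-Reasoning

Shape-2+ : ∀ {v k} → 2 ≤ k → Shape v k → Shape (2 + v) (1 + k)
Shape-2+ k≥2 (small p) = small (2+-small (4≤2^n k≥2) p)
Shape-2+ (s≤s (s≤s z≤n)) (power (suc (suc t))) =
  subst (λ v → Shape v (3 + t)) (*-distribˡ-+ 2 1 (2 ^ suc t)) (twoPowers 0 t)
Shape-2+ _ (twoPowers j t) = small (begin
  2 * (2 + 2 ^ suc j * (1 + 2 ^ suc t))  ≤⟨ *-monoʳ-≤ 2 (2+m*[1+n]≤m*[2*n] (2≤2^[1+n] j) (2≤2^[1+n] t)) ⟩
  2 * (2 ^ suc j * 2 ^ suc (suc t))      ≡⟨ cong (2 *_) (^-distribˡ-+-* 2 (suc j) (suc (suc t))) ⟨
  2 ^ (1 + (suc j + suc (suc t)))        ∎)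
  where open ≤-Reasoning

Shape-+ : ∀ {a b k l} → 2 ≤ k → 2 ≤ l → Shape a k → Shape b l → Shape (a + b) (k + l)
Shape-+ {a} {b} {k} {l} k≥2 l≥2 sa sb = small (begin
  2 * (a + b)          ≤⟨ *-monoʳ-≤ 2 (+-mono-≤ (Shape-≤ sa) (Shape-≤ sb)) ⟩
  2 * (2 ^ k + 2 ^ l)  ≤⟨ 2*[m+n]≤m*n (4≤2^n k≥2) (4≤2^n l≥2) ⟩
  2 ^ k * 2 ^ l        ≡⟨ ^-distribˡ-+-* 2 k l ⟨
  2 ^ (k + l)          ∎)
  where open ≤-Reasoning

small-* : ∀ {a b k l} → 2 * a ≤ 2 ^ k → b ≤ 2 ^ l → 2 * (a * b) ≤ 2 ^ (k + l)
small-* {a} {b} {k} {l} p q = begin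
  2 * (a * b)    ≡⟨ *-assoc 2 a b ⟨
  2 * a * b      ≤⟨ *-mono-≤ p q ⟩
  2 ^ k * 2 ^ l  ≡⟨ ^-distribˡ-+-* 2 k l ⟨
  2 ^ (k + l)    ∎
  where open ≤-Reasoning

power-*-twoPowers : ∀ k j t →
  Shape (2 ^ k * (2 ^ suc j * (1 + 2 ^ suc t))) (k + (suc j + suc (suc t)))
power-*-twoPowers k j t = subst₂ Shape value index (twoPowers (k + j) t)
  where
  value : 2 ^ suc (k + j) * (1 + 2 ^ suc t) ≡ 2 ^ k * (2 ^ suc j * (1 + 2 ^ suc t))
  value = begin
    2 ^ suc (k + j) * (1 + 2 ^ suc t)      ≡⟨ cong (λ i → 2 ^ i * (1 + 2 ^ suc t)) (+-suc k j) ⟨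
    2 ^ (k + suc j) * (1 + 2 ^ suc t)      ≡⟨ cong (_* (1 + 2 ^ suc t)) (^-distribˡ-+-* 2 k (suc j)) ⟩
    2 ^ k * 2 ^ suc j * (1 + 2 ^ suc t)    ≡⟨ *-assoc (2 ^ k) (2 ^ suc j) (1 + 2 ^ suc t) ⟩
    2 ^ k * (2 ^ suc j * (1 + 2 ^ suc t))  ∎
    where open ≡-Reasoning
  index : suc (k + j) + suc (suc t) ≡ k + (suc j + suc (suc t))
  index = trans (cong (_+ suc (suc t)) (sym (+-suc k j))) (+-assoc k (suc j) (suc (suc t)))

twoPowers-*-twoPowers : ∀ i s j t →
  Shape (2 ^ suc i * (1 + 2 ^ suc (suc s)) * (2 ^ suc j * (1 + 2 ^ suc t)))
        (suc i + suc (suc (suc s)) + (suc j + suc (suc t)))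
twoPowers-*-twoPowers i s j t = small (begin
  2 * (m * (1 + S) * (n * (1 + T)))        ≡⟨ regroup m n (1 + S) (1 + T) ⟩
  m * n * (2 * ((1 + S) * (1 + T)))        ≤⟨ *-monoʳ-≤ (m * n) (*-monoʳ-≤ 2 S*T-bound) ⟩
  m * n * (2 * (2 * (S * T)))              ≡⟨ regroup′ m n S T ⟩
  m * (2 * S) * (n * (2 * T))              ≡⟨ cong₂ _*_ (^-distribˡ-+-* 2 (suc i) (2 + suc s))
                                                        (^-distribˡ-+-* 2 (suc j) (suc (suc t))) ⟨
  2 ^ (suc i + suc (suc (suc s))) * 2 ^ (suc j + suc (suc t))
                                           ≡⟨ ^-distribˡ-+-* 2 (suc i + suc (suc (suc s))) (suc j + suc (suc t)) ⟨
  2 ^ (suc i + suc (suc (suc s)) + (suc j + suc (suc t))) ∎)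
  where
  open ≤-Reasoning
  m = 2 ^ suc i
  n = 2 ^ suc j
  S = 2 ^ suc (suc s)
  T = 2 ^ suc t
  S*T-bound : (1 + S) * (1 + T) ≤ 2 * (S * T)
  S*T-bound = [1+m]*[1+n]≤2*[m*n] (4≤2^n {suc (suc s)} (s≤s (s≤s z≤n))) (2≤2^[1+n] t)
  regroup : ∀ m n x y → 2 * (m * x * (n * y)) ≡ m * n * (2 * (x * y))
  regroup = solve-∀
  regroup′ : ∀ m n x y → m * n * (2 * (2 * (x * y))) ≡ m * (2 * x) * (n * (2 * y))
  regroup′ = solve-∀

-- The one product of two twoPowers values that is not small:
-- 3 * 2 ^ a * (3 * 2 ^ b) = 2 ^ (a + b) + 2 ^ (a + b + 3).
threes-*-threes : ∀ i j →
  Shape (2 ^ suc i * 3 * (2 ^ suc j * 3)) (suc i + 2 + (suc j + 2))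
threes-*-threes i j = subst₂ Shape value (index i j) (twoPowers (suc (i + j)) 2)
  where
  value : 2 ^ suc (suc (i + j)) * 9 ≡ 2 ^ suc i * 3 * (2 ^ suc j * 3)
  value = trans (cong (λ x → 2 * (2 * x) * 9) (^-distribˡ-+-* 2 i j)) (regroup (2 ^ i) (2 ^ j))
    where
    regroup : ∀ x y → 2 * (2 * (x * y)) * 9 ≡ 2 * x * 3 * (2 * y * 3)
    regroup = solve-∀
  index : ∀ i j → suc (suc (i + j)) + 4 ≡ suc i + 2 + (suc j + 2)
  index = solve-∀

Shape-* : ∀ {a b k l} → Shape a k → Shape b l → Shape (a * b) (k + l)
Shape-* {a} {b} {k} {l} (small p) sb = small (small-* {a} {b} {k} {l} p (Shape-≤ sb))
Shape-* {a} {b} {k} {l} sa (small q) =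
  Shape-*-comm {b} {a} {l} {k} (small (small-* {b} {a} {l} {k} q (Shape-≤ sa)))
Shape-* (power k) (power l) = subst (λ v → Shape v (k + l)) (^-distribˡ-+-* 2 k l) (power (k + l))
Shape-* (power k) (twoPowers j t) = power-*-twoPowers k j t
Shape-* {a} {b} {k} {l} (twoPowers j t) (power _) = Shape-*-comm {b} {a} {l} {k} (power-*-twoPowers l j t)
Shape-* (twoPowers i zero) (twoPowers j zero) = threes-*-threes i j
Shape-* (twoPowers i (suc s)) (twoPowers j t) = twoPowers-*-twoPowers i s j t
Shape-* {a} {b} {k} {l} (twoPowers i zero) (twoPowers j (suc t)) =
  Shape-*-comm {b} {a} {l} {k} (twoPowers-*-twoPowers j t i zero)

1≤twos : ∀ e → 1 ≤ twos e
1≤twos two = s≤s z≤n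
1≤twos (a ⊕ b) = ≤-trans (1≤twos a) (m≤m+n (twos a) (twos b))
1≤twos (a ⊗ b) = ≤-trans (1≤twos a) (m≤m+n (twos a) (twos b))

two⊎2≤twos : ∀ e → e ≡ two ⊎ 2 ≤ twos e
two⊎2≤twos two = inj₁ refl
two⊎2≤twos (a ⊕ b) = inj₂ (+-mono-≤ (1≤twos a) (1≤twos b))
two⊎2≤twos (a ⊗ b) = inj₂ (+-mono-≤ (1≤twos a) (1≤twos b))

shape : ∀ e → Shape ⟦ e ⟧ (twos e)
shape two = power 1
shape (a ⊗ b) = Shape-* (shape a) (shape b)
shape (a ⊕ b) with two⊎2≤twos a | two⊎2≤twos b
... | inj₁ refl | inj₁ refl = power 2
... | inj₁ refl | inj₂ l≥2 = Shape-2+ l≥2 (shape b)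
... | inj₂ k≥2 | inj₁ refl = Shape-+-comm {2} {⟦ a ⟧} {1} {twos a} (Shape-2+ k≥2 (shape a))
... | inj₂ k≥2 | inj₂ l≥2 = Shape-+ k≥2 l≥2 (shape a) (shape b)

Shape⇒small : ∀ {v k} → ((i : ℕ) → v ≢ 2 ^ i) → ((a b : ℕ) → v ≢ 2 ^ a + 2 ^ b) →
  Shape v k → 2 * v ≤ 2 ^ k
Shape⇒small _ _ (small p) = p
Shape⇒small v≢2^i _ (power k) = ⊥-elim (v≢2^i k refl)
Shape⇒small _ v≢2^a+2^b (twoPowers j t) = ⊥-elim (v≢2^a+2^b (suc j) (suc j + suc t) (begin
  2 ^ suc j * (1 + 2 ^ suc t)          ≡⟨ *-distribˡ-+ (2 ^ suc j) 1 (2 ^ suc t) ⟩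
  2 ^ suc j * 1 + 2 ^ suc j * 2 ^ suc t ≡⟨ cong₂ _+_ (*-identityʳ (2 ^ suc j)) (sym (^-distribˡ-+-* 2 (suc j) (suc t))) ⟩
  2 ^ suc j + 2 ^ (suc j + suc t)      ∎))
  where open ≡-Reasoning

2*n≤2^k⇒⌈log₂n⌉+1≤k : ∀ {n k} .{{_ : NonZero n}} → 2 * n ≤ 2 ^ k → ⌈log₂ n ⌉ + 1 ≤ k
2*n≤2^k⇒⌈log₂n⌉+1≤k {n} {k} p = begin
  ⌈log₂ n ⌉ + 1      ≡⟨ +-comm ⌈log₂ n ⌉ 1 ⟩
  1 + ⌈log₂ n ⌉      ≡⟨ ⌈log₂2*n⌉≡1+⌈log₂n⌉ n ⟨
  ⌈log₂ (2 * n) ⌉    ≤⟨ ⌈log₂⌉-mono-≤ p ⟩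
  ⌈log₂ (2 ^ k) ⌉    ≡⟨ ⌈log₂2^n⌉≡n k ⟩
  k                  ∎
  where open ≤-Reasoning

corollary3p3 : (n : ℕ) → n ≢ 0 → (∃ λ m → n ≡ 2 * m)
    → ((k : ℕ) → n ≢ 2 ^ k)
    → ((a b : ℕ) → n ≢ 2 ^ a + 2 ^ b)
    → ⌈log₂ n ⌉ + 1 ≤‖ n ‖₂
corollary3p3 n n≢0 _ n≢2^k n≢2^a+2^b e refl =
  2*n≤2^k⇒⌈log₂n⌉+1≤k {{≢-nonZero n≢0}} (Shape⇒small n≢2^k n≢2^a+2^b (shape e))
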